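{- For every integer $k \geq 1$, let $\mathcal{C}(k)$ denote the greatest common divisor of all the integers $\sum_{i=1}^{k} C_{n+i}$ for $n \geq 0$. Then $$\mathcal{C}(k) = \begin{cases} 2P_{k}, & \text{if } k \text{ is even};\\ Q_{k}, & \text{if } k \text{ is odd}.\end{cases}$$
   Context: The Lucas-balancing sequence $(C_n)_{n\ge 0}$ is defined by $C_0=1$, $C_1=3$, $C_n=6C_{n-1}-C_{n-2}$ for $n\ge 2$. The Pell sequence $(P_n)_{n\ge 0}$ is defined by $P_0=0$, $P_1=1$, $P_n=2P_{n-1}+P_{n-2}$; the associated Pell sequence $(Q_n)_{n\ge 0}$ by $Q_0=1$, $Q_1=1$, $Q_n=2Q_{n-1}+Q_{n-2}$. -}

module Defs where

open import Data.Nat using (ℕ; zero; suc; _+_; _*_; _∸_)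
open import Data.Nat.Divisibility using (_∣_)
open import Data.Product using (_×_)

-- Lucas-balancing numbers: C 0 = 1, C 1 = 3, C n = 6 C (n-1) - C (n-2).
-- (The sequence is increasing, so truncated subtraction is exact here.)
C : ℕ → ℕ
C zero = 1
C (suc zero) = 3
C (suc (suc n)) = 6 * C (suc n) ∸ C n

P : ℕ → ℕ
P zero = 0
P (suc zero) = 1
P (suc (suc n)) = 2 * P (suc n) + P n

Q : ℕ → ℕ
Q zero = 1
Q (suc zero) = 1
Q (suc (suc n)) = 2 * Q (suc n) + Q n

sumC : ℕ → ℕ → ℕ
sumC zero n = 0
sumC (suc k) n = sumC k n + C (n + suc k)

IsGCDOf : (ℕ → ℕ) → ℕ → Set
IsGCDOf f d = (∀ n → d ∣ f n) × (∀ e → (∀ n → e ∣ f n) → e ∣ d)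

-- Write Q n + P n √2 = (1 + √2)ⁿ. Then C n = Q (2n), and since Q (m + 2) − Q m = 2 Q (m + 1),
-- twice the sum telescopes to Q (j + 2k) − Q j with j = 2n + 1. The addition formulas and
-- Cassini's identity Q k² − 2 P k² = (−1)ᵏ turn this difference into 4 P k P (j + k) for even k
-- and into 2 Q k Q (j + k) for odd k, so the claimed value d divides every sum, with cofactor
-- Y (n + t) for a sequence Y obeying Y (i + 2) = 6 Y (i + 1) − Y i and Y 0 = 1. Conversely, a
-- common divisor of the sums for n = 0, 1 divides d Y t and d Y (t + 1), hence, running the
-- recurrence backwards, it divides d Y 0 = d.
module Submission where

open import Algebra.Properties.CommutativeSemigroup as CommSemigroupProperties using ()
open import Data.List using (_∷_; [])
open import Data.Nat using (ℕ; zero; suc; _+_; _*_; _∸_; _≤_)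
open import Data.Nat.Divisibility
  using (_∣_; divides; m∣m*n; ∣n⇒∣m*n; ∣m+n∣m⇒∣n; ∣m∣n⇒∣m+n; ∣-refl)
open import Data.Nat.Properties
  using (+-assoc; +-comm; +-identityʳ; +-cancelˡ-≡; +-cancelʳ-≡;
         *-identityˡ; *-identityʳ; *-zeroʳ; *-distribˡ-+; *-cancelˡ-≡; m+n∸n≡m;
         *-commutativeSemigroup)
open import Data.Nat.Tactic.RingSolver using (solve)
open import Data.Empty using (⊥-elim)
open import Data.Product using (_×_; _,_; ∃-syntax; map)
open import Relation.Nullary using (¬_)
open import Relation.Binary.PropositionalEquality
  using (_≡_; refl; sym; trans; cong; cong₂; subst; subst₂; module ≡-Reasoning)
open import Defs

open CommSemigroupProperties *-commutativeSemigroup using (x∙yz≈y∙xz)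
open ≡-Reasoning

PellRecurrence : (ℕ → ℕ) → Set
PellRecurrence R = ∀ n → R (2 + n) ≡ 2 * R (1 + n) + R n

ChebyshevRecurrence : ℕ → (ℕ → ℕ) → Set
ChebyshevRecurrence c Y = ∀ i → Y (2 + i) + Y i ≡ c * Y (1 + i)

P-pell : PellRecurrence P
P-pell _ = refl

Q-pell : PellRecurrence Q
Q-pell _ = refl

pell-unique : ∀ R S → PellRecurrence R → PellRecurrence S →
              R 0 ≡ S 0 → R 1 ≡ S 1 → ∀ n → R n ≡ S n
pell-unique _ _ _ _ e₀ _ zero = e₀
pell-unique _ _ _ _ _ e₁ (suc zero) = e₁
pell-unique R S r s e₀ e₁ (suc (suc n)) = begin
  R (2 + n)              ≡⟨ r n ⟩
  2 * R (1 + n) + R n    ≡⟨ cong₂ (λ x y → 2 * x + y) (pell-unique R S r s e₀ e₁ (suc n))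
                                                      (pell-unique R S r s e₀ e₁ n) ⟩
  2 * S (1 + n) + S n    ≡⟨ sym (s n) ⟩
  S (2 + n)              ∎

pell-linear : ∀ {R S} → PellRecurrence R → PellRecurrence S →
              ∀ x y → PellRecurrence (λ n → x * R n + y * S n)
pell-linear r s x y n = combine (r n) (s n)
  where
  combine : ∀ {r₂ r₁ r₀ s₂ s₁ s₀} → r₂ ≡ 2 * r₁ + r₀ → s₂ ≡ 2 * s₁ + s₀ →
            x * r₂ + y * s₂ ≡ 2 * (x * r₁ + y * s₁) + (x * r₀ + y * s₀)
  combine {r₁ = r₁} {r₀} {s₁ = s₁} {s₀} refl refl = solve (x ∷ y ∷ r₁ ∷ r₀ ∷ s₁ ∷ s₀ ∷ [])

pell-even-steps : ∀ {R} → PellRecurrence R → ∀ a → ChebyshevRecurrence 6 (λ i → R (a + i * 2))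
pell-even-steps {R} pell a i =
  subst₂ (λ u v → R u + R m ≡ 6 * R v) (sym a+[2+i]*2) (sym a+[1+i]*2)
         (skip (pell (2 + m)) (pell (1 + m)) (pell m))
  where
  m = a + i * 2
  a+[2+i]*2 : a + (2 + i) * 2 ≡ 4 + (a + i * 2)
  a+[2+i]*2 = solve (a ∷ i ∷ [])
  a+[1+i]*2 : a + (1 + i) * 2 ≡ 2 + (a + i * 2)
  a+[1+i]*2 = solve (a ∷ i ∷ [])
  skip : ∀ {r₄ r₃ r₂ r₁ r₀} → r₄ ≡ 2 * r₃ + r₂ → r₃ ≡ 2 * r₂ + r₁ → r₂ ≡ 2 * r₁ + r₀ →
         r₄ + r₀ ≡ 6 * r₂
  skip {r₁ = r₁} {r₀} refl refl refl = solve (r₁ ∷ r₀ ∷ [])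

P-suc : ∀ n → P (suc n) ≡ P n + Q n
P-suc n = trans
  (pell-unique (λ m → P (suc m)) (λ m → 1 * P m + 1 * Q m)
               (λ _ → refl) (pell-linear {P} {Q} P-pell Q-pell 1 1) refl refl n)
  (cong₂ _+_ (*-identityˡ (P n)) (*-identityˡ (Q n)))

Q-suc : ∀ n → Q (suc n) ≡ Q n + 2 * P n
Q-suc n = trans
  (pell-unique (λ m → Q (suc m)) (λ m → 1 * Q m + 2 * P m)
               (λ _ → refl) (pell-linear {Q} {P} Q-pell P-pell 1 2) refl refl n)
  (cong (_+ 2 * P n) (*-identityˡ (Q n)))

Q-+ : ∀ a b → Q (a + b) ≡ Q b * Q a + 2 * P b * P a
Q-+ a b = pell-unique (λ m → Q (m + b)) (λ m → Q b * Q m + 2 * P b * P m)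
                      (λ m → Q-pell (m + b))
                      (pell-linear {Q} {P} Q-pell P-pell (Q b) (2 * P b)) at-0 at-1 a
  where
  at-0 : Q b ≡ Q b * 1 + 2 * P b * 0
  at-0 = sym (trans (cong₂ _+_ (*-identityʳ (Q b)) (*-zeroʳ (2 * P b))) (+-identityʳ (Q b)))
  at-1 : Q (suc b) ≡ Q b * 1 + 2 * P b * 1
  at-1 = trans (Q-suc b) (sym (cong₂ _+_ (*-identityʳ (Q b)) (*-identityʳ (2 * P b))))

P-+ : ∀ a b → P (a + b) ≡ P b * Q a + Q b * P a
P-+ a b = pell-unique (λ m → P (m + b)) (λ m → P b * Q m + Q b * P m)
                      (λ m → P-pell (m + b))
                      (pell-linear {Q} {P} Q-pell P-pell (P b) (Q b)) at-0 at-1 a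
  where
  at-0 : P b ≡ P b * 1 + Q b * 0
  at-0 = sym (trans (cong₂ _+_ (*-identityʳ (P b)) (*-zeroʳ (Q b))) (+-identityʳ (P b)))
  at-1 : P (suc b) ≡ P b * 1 + Q b * 1
  at-1 = trans (P-suc b) (sym (cong₂ _+_ (*-identityʳ (P b)) (*-identityʳ (Q b))))

cassini-step : ∀ n → Q (1 + n) * Q (1 + n) + Q n * Q n
                   ≡ 2 * (P (1 + n) * P (1 + n)) + 2 * (P n * P n)
cassini-step n = flip {p = P n} {Q n} (P-suc n) (Q-suc n)
  where
  flip : ∀ {p′ q′ p q} → p′ ≡ p + q → q′ ≡ q + 2 * p →
         q′ * q′ + q * q ≡ 2 * (p′ * p′) + 2 * (p * p)
  flip {p = p} {q} refl refl = solve (p ∷ q ∷ [])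

x+y≡z+w∧y≡w+1⇒z≡x+1 : ∀ {x y z w} → x + y ≡ z + w → y ≡ w + 1 → z ≡ x + 1
x+y≡z+w∧y≡w+1⇒z≡x+1 {x} {z = z} {w} eq refl = +-cancelʳ-≡ w z (x + 1) (begin
  z + w          ≡⟨ sym eq ⟩
  x + (w + 1)    ≡⟨ solve (x ∷ w ∷ []) ⟩
  x + 1 + w      ∎)

cassini-even : ∀ m → Q (m * 2) * Q (m * 2) ≡ 2 * (P (m * 2) * P (m * 2)) + 1
cassini-odd  : ∀ m → 2 * (P (1 + m * 2) * P (1 + m * 2)) ≡ Q (1 + m * 2) * Q (1 + m * 2) + 1

cassini-even zero = refl
cassini-even (suc m) = x+y≡z+w∧y≡w+1⇒z≡x+1 (sym (cassini-step (1 + m * 2))) (cassini-odd m)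

cassini-odd m = x+y≡z+w∧y≡w+1⇒z≡x+1 (cassini-step (m * 2)) (cassini-even m)

Q-double-shift : ∀ k a → Q (a + k * 2) ≡ Q a * (Q k * Q k + 2 * (P k * P k)) + 4 * P k * Q k * P a
Q-double-shift k a = begin
  Q (a + k * 2)                          ≡⟨ cong Q a+k*2≡a+k+k ⟩
  Q (a + k + k)                          ≡⟨ Q-+ (a + k) k ⟩
  Q k * Q (a + k) + 2 * P k * P (a + k)  ≡⟨ expand (Q a) (P a) (Q k) (P k) (Q-+ a k) (P-+ a k) ⟩
  Q a * (Q k * Q k + 2 * (P k * P k)) + 4 * P k * Q k * P a ∎
  where
  a+k*2≡a+k+k : a + k * 2 ≡ a + k + k
  a+k*2≡a+k+k = solve (a ∷ k ∷ [])
  expand : ∀ qa pa qk pk {x y} → x ≡ qk * qa + 2 * pk * pa → y ≡ pk * qa + qk * pa →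
           qk * x + 2 * pk * y ≡ qa * (qk * qk + 2 * (pk * pk)) + 4 * pk * qk * pa
  expand qa pa qk pk refl refl = solve (qa ∷ pa ∷ qk ∷ pk ∷ [])

Q-double-shift-even : ∀ k → Q k * Q k ≡ 2 * (P k * P k) + 1 →
                      ∀ a → Q (a + k * 2) ≡ Q a + 2 * (2 * P k * P (a + k))
Q-double-shift-even k cassini a = begin
  Q (a + k * 2)                                              ≡⟨ Q-double-shift k a ⟩
  Q a * (Q k * Q k + 2 * (P k * P k)) + 4 * P k * Q k * P a  ≡⟨ regroup (Q a) (P a) (Q k) (P k) cassini ⟩
  Q a + 2 * (2 * P k * (P k * Q a + Q k * P a))              ≡⟨ cong (λ y → Q a + 2 * (2 * P k * y)) (P-+ a k) ⟨
  Q a + 2 * (2 * P k * P (a + k))                            ∎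
  where
  regroup : ∀ qa pa qk pk {s} → s ≡ 2 * (pk * pk) + 1 →
            qa * (s + 2 * (pk * pk)) + 4 * pk * qk * pa ≡ qa + 2 * (2 * pk * (pk * qa + qk * pa))
  regroup qa pa qk pk refl = solve (qa ∷ pa ∷ qk ∷ pk ∷ [])

Q-double-shift-odd : ∀ k → 2 * (P k * P k) ≡ Q k * Q k + 1 →
                     ∀ a → Q (a + k * 2) ≡ Q a + 2 * (Q k * Q (a + k))
Q-double-shift-odd k cassini a = begin
  Q (a + k * 2)                                              ≡⟨ Q-double-shift k a ⟩
  Q a * (Q k * Q k + 2 * (P k * P k)) + 4 * P k * Q k * P a  ≡⟨ regroup (Q a) (P a) (Q k) (P k) cassini ⟩
  Q a + 2 * (Q k * (Q k * Q a + 2 * P k * P a))              ≡⟨ cong (λ y → Q a + 2 * (Q k * y)) (Q-+ a k) ⟨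
  Q a + 2 * (Q k * Q (a + k))                                ∎
  where
  regroup : ∀ qa pa qk pk {s} → s ≡ qk * qk + 1 →
            qa * (qk * qk + s) + 4 * pk * qk * pa ≡ qa + 2 * (qk * (qk * qa + 2 * pk * pa))
  regroup qa pa qk pk refl = solve (qa ∷ pa ∷ qk ∷ pk ∷ [])

C[n]≡Q[n*2] : ∀ n → C n ≡ Q (n * 2)
C[n]≡Q[n*2] zero = refl
C[n]≡Q[n*2] (suc zero) = refl
C[n]≡Q[n*2] (suc (suc n)) = begin
  6 * C (1 + n) ∸ C n                    ≡⟨ cong₂ (λ x y → 6 * x ∸ y) (C[n]≡Q[n*2] (suc n)) (C[n]≡Q[n*2] n) ⟩
  6 * Q ((1 + n) * 2) ∸ Q (n * 2)        ≡⟨ cong (_∸ Q (n * 2)) (pell-even-steps {Q} Q-pell 0 n) ⟨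
  Q ((2 + n) * 2) + Q (n * 2) ∸ Q (n * 2) ≡⟨ m+n∸n≡m (Q ((2 + n) * 2)) (Q (n * 2)) ⟩
  Q ((2 + n) * 2)                        ∎

sumC-telescopes : ∀ k n → Q (1 + n * 2) + 2 * sumC k n ≡ Q (1 + n * 2 + k * 2)
sumC-telescopes zero n =
  trans (+-identityʳ (Q (1 + n * 2))) (cong Q (sym (+-identityʳ (1 + n * 2))))
sumC-telescopes (suc k) n = begin
  Q j + 2 * (sumC k n + C (n + suc k))        ≡⟨ cong (Q j +_) (*-distribˡ-+ 2 (sumC k n) _) ⟩
  Q j + (2 * sumC k n + 2 * C (n + suc k))    ≡⟨ +-assoc (Q j) _ _ ⟨
  Q j + 2 * sumC k n + 2 * C (n + suc k)      ≡⟨ cong₂ _+_ (sumC-telescopes k n)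
                                                          (cong (2 *_) (C[n]≡Q[n*2] (n + suc k))) ⟩
  Q (j + k * 2) + 2 * Q ((n + suc k) * 2)     ≡⟨ cong (λ i → Q (j + k * 2) + 2 * Q i) [n+1+k]*2≡1+j+k*2 ⟩
  Q (j + k * 2) + 2 * Q (1 + (j + k * 2))     ≡⟨ +-comm (Q (j + k * 2)) _ ⟩
  Q (2 + (j + k * 2))                         ≡⟨ cong Q 2+j+k*2≡j+[1+k]*2 ⟩
  Q (j + suc k * 2)                           ∎
  where
  j = 1 + n * 2
  [n+1+k]*2≡1+j+k*2 : (n + suc k) * 2 ≡ 1 + (1 + n * 2 + k * 2)
  [n+1+k]*2≡1+j+k*2 = solve (n ∷ k ∷ [])
  2+j+k*2≡j+[1+k]*2 : 2 + (1 + n * 2 + k * 2) ≡ 1 + n * 2 + suc k * 2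
  2+j+k*2≡j+[1+k]*2 = solve (n ∷ k ∷ [])

sumC-even : ∀ k → Q k * Q k ≡ 2 * (P k * P k) + 1 → ∀ n → sumC k n ≡ 2 * P k * P (1 + n * 2 + k)
sumC-even k cassini n =
  *-cancelˡ-≡ _ _ 2 (+-cancelˡ-≡ (Q j) _ _
    (trans (sumC-telescopes k n) (Q-double-shift-even k cassini j)))
  where
  j = 1 + n * 2

sumC-odd : ∀ k → 2 * (P k * P k) ≡ Q k * Q k + 1 → ∀ n → sumC k n ≡ Q k * Q (1 + n * 2 + k)
sumC-odd k cassini n =
  *-cancelˡ-≡ _ _ 2 (+-cancelˡ-≡ (Q j) _ _
    (trans (sumC-telescopes k n) (Q-double-shift-odd k cassini j)))
  where
  j = 1 + n * 2

chebyshev-scale : ∀ {c Y} d → ChebyshevRecurrence c Y → ChebyshevRecurrence c (λ i → d * Y i)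
chebyshev-scale {c} {Y} d rec i = begin
  d * Y (2 + i) + d * Y i    ≡⟨ *-distribˡ-+ d (Y (2 + i)) (Y i) ⟨
  d * (Y (2 + i) + Y i)      ≡⟨ cong (d *_) (rec i) ⟩
  d * (c * Y (1 + i))        ≡⟨ x∙yz≈y∙xz d c (Y (1 + i)) ⟩
  c * (d * Y (1 + i))        ∎

∣-chebyshev-descent : ∀ {c Y e} → ChebyshevRecurrence c Y →
                      ∀ t → e ∣ Y t → e ∣ Y (1 + t) → e ∣ Y 0
∣-chebyshev-descent rec zero e∣Y₀ _ = e∣Y₀
∣-chebyshev-descent {c} {Y} {e} rec (suc t) e∣Y[1+t] e∣Y[2+t] =
  ∣-chebyshev-descent {c} {Y} rec t e∣Y[t] e∣Y[1+t]
  where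
  e∣Y[t] : e ∣ Y t
  e∣Y[t] = ∣m+n∣m⇒∣n (subst (e ∣_) (sym (rec t)) (∣n⇒∣m*n c e∣Y[1+t])) e∣Y[2+t]

isGCDOf-chebyshev-multiple : ∀ {c f} Y d t → ChebyshevRecurrence c Y → Y 0 ≡ 1 →
                             (∀ n → f n ≡ d * Y (n + t)) → IsGCDOf f d
isGCDOf-chebyshev-multiple {c} {f} Y d t rec Y₀≡1 f≡dY =
  (λ n → subst (d ∣_) (sym (f≡dY n)) (m∣m*n (Y (n + t)))) , greatest
  where
  greatest : ∀ e → (∀ n → e ∣ f n) → e ∣ d
  greatest e e∣f = subst (e ∣_) (trans (cong (d *_) Y₀≡1) (*-identityʳ d))
    (∣-chebyshev-descent {c} {λ i → d * Y i} (chebyshev-scale {c} {Y} d rec) t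
      (subst (e ∣_) (f≡dY 0) (e∣f 0)) (subst (e ∣_) (f≡dY 1) (e∣f 1)))

sumC-isGCD-even : ∀ m → IsGCDOf (sumC (m * 2)) (2 * P (m * 2))
sumC-isGCD-even m =
  isGCDOf-chebyshev-multiple {6} (λ i → P (1 + i * 2)) (2 * P (m * 2)) m
    (pell-even-steps {P} P-pell 1) refl
    (λ n → trans (sumC-even (m * 2) (cassini-even m) n)
                 (cong (λ i → 2 * P (m * 2) * P i) (reindex n)))
  where
  reindex : ∀ n → 1 + n * 2 + m * 2 ≡ 1 + (n + m) * 2
  reindex n = solve (n ∷ m ∷ [])

sumC-isGCD-odd : ∀ m → IsGCDOf (sumC (1 + m * 2)) (Q (1 + m * 2))
sumC-isGCD-odd m =
  isGCDOf-chebyshev-multiple {6} (λ i → Q (i * 2)) (Q (1 + m * 2)) (1 + m)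
    (pell-even-steps {Q} Q-pell 0) refl
    (λ n → trans (sumC-odd (1 + m * 2) (cassini-odd m) n)
                 (cong (λ i → Q (1 + m * 2) * Q i) (reindex n)))
  where
  reindex : ∀ n → 1 + n * 2 + (1 + m * 2) ≡ (n + (1 + m)) * 2
  reindex n = solve (n ∷ m ∷ [])

¬2∣⇒odd : ∀ {k} → ¬ 2 ∣ k → ∃[ m ] k ≡ 1 + m * 2
¬2∣⇒odd {zero} 2∤0 = ⊥-elim (2∤0 (divides 0 refl))
¬2∣⇒odd {suc zero} _ = 0 , refl
¬2∣⇒odd {suc (suc k)} 2∤2+k =
  map suc (cong (2 +_)) (¬2∣⇒odd (λ 2∣k → 2∤2+k (∣m∣n⇒∣m+n ∣-refl 2∣k)))

theorem18 : (k : ℕ) → 1 ≤ k →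
    (2 ∣ k → IsGCDOf (sumC k) (2 * P k)) × (¬ (2 ∣ k) → IsGCDOf (sumC k) (Q k))
theorem18 k _ = even , odd
  where
  even : 2 ∣ k → IsGCDOf (sumC k) (2 * P k)
  even (divides m k≡m*2) =
    subst (λ k → IsGCDOf (sumC k) (2 * P k)) (sym k≡m*2) (sumC-isGCD-even m)
  odd : ¬ 2 ∣ k → IsGCDOf (sumC k) (Q k)
  odd 2∤k with m , k≡1+m*2 ← ¬2∣⇒odd 2∤k =
    subst (λ k → IsGCDOf (sumC k) (Q k)) (sym k≡1+m*2) (sumC-isGCD-odd m)
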